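{- Let $\Delta$ be an operation that associates with every integer $n\geq 0$ and every simplicial complex $\Gamma$ on the vertex set $[n]=\{1,\ldots,n\}$ a shifted simplicial complex $\Delta(\Gamma)$ on the same vertex set $[n]$. Assume that $\Delta$ satisfies the following properties, for all $n$ and all complexes on $[n]$: (1) $f(\Delta(\Gamma))=f(\Gamma)$; (2) $\Delta(\Gamma\ast\{n+1\})=\Delta(\Gamma)\ast\{n+1\}$; (3) if $\Gamma'\subseteq\Gamma$, then $\Delta(\Gamma')\subseteq\Delta(\Gamma)$; (4) $\sum_{i=0}^{\dim\Gamma}\beta_i(\Gamma)\leq\sum_{i=0}^{\dim\Delta(\Gamma)}\beta_i(\Delta(\Gamma))$. Then for every shifted complex $\Gamma$, $\Delta(\Gamma)=\Gamma$.
   Context: A simplicial complex on the vertex set $[n]$ is a collection $\Gamma$ of subsets of $[n]$ closed under taking subsets (it is not required that every singleton $\{i\}$ be in $\Gamma$). Elements are faces; $\dim F=|F|-1$; $\dim\Gamma$ is the maximal face dimension. The $f$-vector is $f(\Gamma)=(f_{ -1},f_0,\ldots,f_{\dim\Gamma})$ where $f_i$ is the number of faces of dimension $i$. $\beta_i(\Gamma)=\dim_{\mathbf k}\widetilde H_i(\Gamma;\mathbf k)$ are the reduced simplicial Betti numbers over a fixed field $\mathbf k$. $\Gamma$ is shifted if for every $F\in\Gamma$, $i\in F$ and $i<j\leq n$, the set $(F\setminus\{i\})\cup\{j\}$ is in $\Gamma$. The cone $\Gamma\ast\{n+1\}$ is the complex on $[n+1]$ whose faces are the faces of $\Gamma$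 together with $\{F\cup\{n+1\}: F\in\Gamma\}$. -}

module Defs where

open import Level using (Level; _⊔_)
open import Data.Nat as ℕ using (ℕ; zero; suc; _∸_; _<_; _≤_)
open import Data.Bool using (Bool; true; false; if_then_else_; _∧_; not)
import Data.Bool.Properties as BoolP
open import Data.Fin as Fin using (Fin; toℕ)
open import Data.Vec as Vec using (Vec; []; _∷_; _[_]≔_; lookup)
import Data.Vec.Properties as VecP
open import Data.List as List using (List; []; _∷_; length; filter)
open import Data.Product using (Σ; _×_; _,_; ∃)
open import Relation.Nullary using (¬_; Dec; yes; no; does)
open import Relation.Binary.PropositionalEquality using (_≡_)
open import Algebra.Bundles using (CommutativeRing)
open import Function.Definitions using (Injective)

record Field (c ℓ : Level) : Set (Level.suc (c ⊔ ℓ)) where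
  field
    commutativeRing : CommutativeRing c ℓ
  open CommutativeRing commutativeRing public
  field
    0≉1     : ¬ (0# ≈ 1#)
    inverse : ∀ x → ¬ (x ≈ 0#) → Σ Carrier λ y → (x * y) ≈ 1#

-- Subsets of [n]. Vertex i+1 of [n] is position i (a Fin n) of a
-- Vec Bool n; so the vertex order is the order of toℕ, and vertex n+1
-- of [n+1] is the last position.

Subset : ℕ → Set
Subset n = Vec Bool n

_∈_ : ∀ {n} → Fin n → Subset n → Set
i ∈ F = lookup F i ≡ true

_⊆_ : ∀ {n} → Subset n → Subset n → Set
G ⊆ F = ∀ i → i ∈ G → i ∈ F

card : ∀ {n} → Subset n → ℕ
card []          = 0
card (true ∷ F)  = suc (card F)
card (false ∷ F) = card F

_≟ˢ_ : ∀ {n} (F G : Subset n) → Dec (F ≡ G)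
_≟ˢ_ = VecP.≡-dec BoolP._≟_

allSubsets : ∀ n → List (Subset n)
allSubsets zero    = [] ∷ []
allSubsets (suc n) = List.map (false ∷_) (allSubsets n) List.++ List.map (true ∷_) (allSubsets n)

-- Simplicial complexes on [n]: a (decidable) family of subsets closed
-- under taking subsets. Singletons need not be faces; the void complex
-- is allowed.

record Complex (n : ℕ) : Set where
  field
    face   : Subset n → Bool
    closed : ∀ F G → G ⊆ F → face F ≡ true → face G ≡ true
open Complex public

_∈ᶜ_ : ∀ {n} → Subset n → Complex n → Set
F ∈ᶜ Γ = face Γ F ≡ true

_⊆ᶜ_ : ∀ {n} → Complex n → Complex n → Set
Γ' ⊆ᶜ Γ = ∀ F → F ∈ᶜ Γ' → F ∈ᶜ Γ

_≐_ : ∀ {n} → Complex n → Complex n → Set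
Γ ≐ Γ' = ∀ F → face Γ F ≡ face Γ' F

Shifted : ∀ {n} → Complex n → Set
Shifted {n} Γ = ∀ F (i j : Fin n) → F ∈ᶜ Γ → i ∈ F → toℕ i < toℕ j →
  ((F [ i ]≔ false) [ j ]≔ true) ∈ᶜ Γ

-- The cone Γ ∗ {n+1}: G ⊆ [n+1] is a face iff G ∖ {n+1} ∈ Γ.
cone : ∀ {n} → Complex n → Complex (suc n)
face   (cone Γ) G = face Γ (Vec.init G)
closed (cone {n} Γ) F G G⊆F = closed Γ (Vec.init F) (Vec.init G) (init-⊆ F G G⊆F)
  where
  open import Relation.Binary.PropositionalEquality using (refl; trans; sym; cong)
  lookup-init : ∀ {m} (H : Subset (suc m)) (i : Fin m) →
                lookup (Vec.init H) i ≡ lookup H (Fin.inject₁ i)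
  lookup-init {suc m} (x ∷ y ∷ H) Fin.zero    = refl
  lookup-init {suc m} (x ∷ y ∷ H) (Fin.suc i) = lookup-init (y ∷ H) i
  init-⊆ : ∀ {m} (F G : Subset (suc m)) → G ⊆ F → Vec.init G ⊆ Vec.init F
  init-⊆ F G G⊆F i i∈G =
    trans (lookup-init F i) (G⊆F (Fin.inject₁ i) (trans (sym (lookup-init G i)) i∈G))

-- Faces of Γ with exactly k elements (dimension k-1), in a fixed order.
facesOfSize : ∀ {n} → Complex n → ℕ → List (Subset n)
facesOfSize {n} Γ k =
  filter (λ F → BoolP.T? (face Γ F ∧ does (card F ℕ.≟ k))) (allSubsets n)

fcount : ∀ {n} → Complex n → ℕ → ℕ
fcount Γ k = length (facesOfSize Γ k)

SameFVector : ∀ {n} → Complex n → Complex n → Set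
SameFVector Γ Γ' = ∀ k → fcount Γ k ≡ fcount Γ' k

module LinAlg {c ℓ} (K : Field c ℓ) where
  open Field K

  Matrix : ℕ → ℕ → Set c
  Matrix r s = Fin r → Fin s → Carrier

  ∑ : ∀ {m} → (Fin m → Carrier) → Carrier
  ∑ {zero}  f = 0#
  ∑ {suc m} f = f Fin.zero + ∑ (λ i → f (Fin.suc i))

  IndepCols : ∀ {r s t} → Matrix r s → (Fin t → Fin s) → Set (c ⊔ ℓ)
  IndepCols {r} {s} {t} M σ =
    ∀ (a : Fin t → Carrier) →
      (∀ row → ∑ (λ j → a j * M row (σ j)) ≈ 0#) → ∀ j → a j ≈ 0#

  HasRank : ∀ {r s} → Matrix r s → ℕ → Set (c ⊔ ℓ)
  HasRank {r} {s} M t =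
    (Σ (Fin t → Fin s) λ σ → Injective _≡_ _≡_ σ × IndepCols M σ) ×
    (∀ (τ : Fin (suc t) → Fin s) → Injective _≡_ _≡_ τ → ¬ IndepCols M τ)

  signPow : ℕ → Carrier
  signPow zero          = 1#
  signPow (suc zero)    = - 1#
  signPow (suc (suc e)) = signPow e

  below : ∀ {n} → Subset n → Fin n → ℕ
  below F v = card (Vec.tabulate λ u → lookup F u ∧ does (toℕ u ℕ.<? toℕ v))

  -- incidence coefficient [F : G] of the simplicial boundary map:
  -- (-1)^{#{u ∈ F : u < v}} if G = F ∖ {v} for some v ∈ F, and 0 otherwise.
  incidence : ∀ {n} → Subset n → Subset n → Carrier
  incidence {n} G F =
    ∑ λ (v : Fin n) →
      if lookup F v ∧ does (G ≟ˢ (F [ v ]≔ false)) then signPow (below F v) else 0#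

  -- matrix of the boundary map ∂ : C_{k-1}(Γ) → C_{k-2}(Γ)
  -- (columns: faces with k elements, rows: faces with k-1 elements);
  -- augmented chain complex, so ∂ on vertices maps to the face ∅.
  boundary : ∀ {n} (Γ : Complex n) (k : ℕ) →
             Matrix (fcount Γ (k ∸ 1)) (fcount Γ k)
  boundary Γ zero    row col = 0#
  boundary Γ (suc k) row col =
    incidence (List.lookup (facesOfSize Γ k) row) (List.lookup (facesOfSize Γ (suc k)) col)

  -- Given the ranks rk k = rank of ∂ on (k-1)-faces, the reduced Betti number
  -- β_{k-1} = f_{k-1} - rank ∂_{k-1} - rank ∂_k  (k = i+1), and
  -- Σ_{i ≥ 0} β_i = Σ_{k=1}^{n} β_{k-1}  (faces have at most n elements,
  -- and β_i = 0 for i > dim Γ).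
  bettiSum : ∀ {n} → Complex n → (ℕ → ℕ) → ℕ
  bettiSum {n} Γ rk = go n
    where
    go : ℕ → ℕ
    go zero    = 0
    go (suc k) = go k ℕ.+ (fcount Γ (suc k) ∸ rk (suc k) ∸ rk (suc (suc k)))

  BoundaryRanks : ∀ {n} → Complex n → (ℕ → ℕ) → Set (c ⊔ ℓ)
  BoundaryRanks Γ rk = ∀ k → HasRank (boundary Γ k) (rk k)

{-# OPTIONS --safe #-}
module Submission where

-- For a set F let ⟨F⟩ (principal F) be the complex of all sets dominated
-- by F, i.e. obtained from F by deleting elements and moving elements to
-- larger vertices; every shifted complex containing F contains ⟨F⟩.
-- By induction on n, F ∈ Δ(⟨F⟩): ⟨F⟩ lies in the cone over its deletion X
-- of the vertex n, and X is shifted on [n-1], so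
-- Δ(⟨F⟩) ⊆ Δ(cone X) = cone (Δ X) = cone X.  Every face of cone X with
-- |F| elements is dominated by F, so the |F|-element faces of Δ(⟨F⟩) are
-- among those of ⟨F⟩; as there are equally many, F is one of them.
-- Hence a shifted Γ satisfies Γ ⊆ Δ(Γ), with equality by the f-vectors.

open import Defs
open import Data.Nat using (ℕ; suc; _≤_)
open import Relation.Binary.PropositionalEquality using (_≡_)

open import Data.Nat using (zero; _+_; _<_; z≤n; s≤s; _≟_)
import Data.Nat.Properties as ℕP
open import Data.Bool using (Bool; true; false; _∧_; T)
open import Data.Fin as Fin using (Fin; toℕ; inject₁)
open import Data.Fin.Properties using (toℕ-inject₁)
open import Data.Vec as Vec using (Vec; []; _∷_; _[_]≔_; lookup; _∷ʳ_)
import Data.List as List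
open import Data.List.Relation.Unary.Any using (here)
open import Data.List.Membership.Propositional using () renaming (_∈_ to _∈ˡ_)
open import Data.List.Membership.Propositional.Properties using (∈-++⁺ˡ; ∈-++⁺ʳ; ∈-map⁺; ∈-filter⁺; ∈-filter⁻)
open import Data.List.Relation.Binary.Sublist.Propositional using (⊆-refl)
open import Data.List.Relation.Binary.Sublist.Propositional.Properties using (filter⁺; to-≋)
open import Data.List.Relation.Binary.Pointwise using (Pointwise-≡⇒≡)
open import Data.Product using (∃; _×_; _,_; proj₁; proj₂)
open import Data.Sum using (_⊎_; inj₁; inj₂)
open import Function using (_∘_)
open import Relation.Binary.PropositionalEquality using (refl; sym; trans; cong; subst; subst₂; module ≡-Reasoning)
open import Relation.Nullary using (does)
open import Relation.Nullary.Decidable using (T?)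
open import Relation.Unary using (Decidable)

-- dominated s G F: can the elements of G be matched injectively to
-- elements of F that are not larger, when s extra elements of F lie
-- below vertex 1?  Decided by scanning [n] upwards greedily.
dominated : ∀ {n} → ℕ → Subset n → Subset n → Bool
dominated s       []          []          = true
dominated s       (false ∷ G) (false ∷ F) = dominated s G F
dominated s       (false ∷ G) (true ∷ F)  = dominated (suc s) G F
dominated s       (true ∷ G)  (true ∷ F)  = dominated s G F
dominated zero    (true ∷ G)  (false ∷ F) = false
dominated (suc s) (true ∷ G)  (false ∷ F) = dominated s G F

dominated-refl : ∀ {n} s (F : Subset n) → dominated s F F ≡ true
dominated-refl s []          = refl
dominated-refl s (false ∷ F) = dominated-refl s F
dominated-refl s (true ∷ F)  = dominated-refl s F

⊆⇒dominated : ∀ {n} s (G F : Subset n) → G ⊆ F → dominated s G F ≡ true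
⊆⇒dominated s []          []          G⊆F = refl
⊆⇒dominated s (false ∷ G) (false ∷ F) G⊆F = ⊆⇒dominated s G F (G⊆F ∘ Fin.suc)
⊆⇒dominated s (false ∷ G) (true ∷ F)  G⊆F = ⊆⇒dominated (suc s) G F (G⊆F ∘ Fin.suc)
⊆⇒dominated s (true ∷ G)  (true ∷ F)  G⊆F = ⊆⇒dominated s G F (G⊆F ∘ Fin.suc)
⊆⇒dominated s (true ∷ G)  (false ∷ F) G⊆F with () ← G⊆F Fin.zero refl

dominated-insert : ∀ {n} s (F : Subset n) j → dominated (suc s) (F [ j ]≔ true) F ≡ true
dominated-insert s (false ∷ F) Fin.zero    = dominated-refl s F
dominated-insert s (true ∷ F)  Fin.zero    = dominated-refl (suc s) F
dominated-insert s (false ∷ F) (Fin.suc j) = dominated-insert s F j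
dominated-insert s (true ∷ F)  (Fin.suc j) = dominated-insert s F j

dominated-shift : ∀ {n} s (F : Subset n) (i j : Fin n) → i ∈ F → toℕ i < toℕ j →
                  dominated s ((F [ i ]≔ false) [ j ]≔ true) F ≡ true
dominated-shift s (true ∷ F)  Fin.zero    (Fin.suc j) i∈F i<j       = dominated-insert s F j
dominated-shift s (false ∷ F) (Fin.suc i) (Fin.suc j) i∈F (s≤s i<j) = dominated-shift s F i j i∈F i<j
dominated-shift s (true ∷ F)  (Fin.suc i) (Fin.suc j) i∈F (s≤s i<j) = dominated-shift s F i j i∈F i<j

dominated-trans : ∀ {n} s t (G F H : Subset n) →
                  dominated s G F ≡ true → dominated t F H ≡ true → dominated (s + t) G H ≡ true
dominated-trans s t [] [] [] _ _ = refl
dominated-trans s t (false ∷ G) (false ∷ F) (false ∷ H) d e = dominated-trans s t G F H d e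
dominated-trans s t (false ∷ G) (false ∷ F) (true ∷ H) d e
  rewrite sym (ℕP.+-suc s t) = dominated-trans s (suc t) G F H d e
dominated-trans s (suc t) (false ∷ G) (true ∷ F) (false ∷ H) d e
  rewrite ℕP.+-suc s t = dominated-trans (suc s) t G F H d e
dominated-trans s t (false ∷ G) (true ∷ F) (true ∷ H) d e = dominated-trans (suc s) t G F H d e
dominated-trans (suc s) t (true ∷ G) (false ∷ F) (false ∷ H) d e = dominated-trans s t G F H d e
dominated-trans (suc s) t (true ∷ G) (false ∷ F) (true ∷ H) d e
  rewrite sym (ℕP.+-suc s t) = dominated-trans s (suc t) G F H d e
dominated-trans s (suc t) (true ∷ G) (true ∷ F) (false ∷ H) d e
  rewrite ℕP.+-suc s t = dominated-trans s t G F H d e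
dominated-trans s t (true ∷ G) (true ∷ F) (true ∷ H) d e = dominated-trans s t G F H d e
dominated-trans zero t (true ∷ G) (false ∷ F) H () e
dominated-trans s zero G (true ∷ F) (false ∷ H) d ()

-- The extra element is either not needed, or can be placed at the first
-- vertex where the matching would otherwise fail.
dominated-unslack : ∀ {n} s (G F : Subset n) → dominated (suc s) G F ≡ true →
                    dominated s G F ≡ true ⊎ ∃ λ j → dominated s G (F [ j ]≔ true) ≡ true
dominated-unslack s [] [] d = inj₁ refl
dominated-unslack s (false ∷ G) (false ∷ F) d with dominated-unslack s G F d
... | inj₁ d′       = inj₁ d′
... | inj₂ (j , d′) = inj₂ (Fin.suc j , d′)
dominated-unslack s (false ∷ G) (true ∷ F) d with dominated-unslack (suc s) G F d
... | inj₁ d′       = inj₁ d′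
... | inj₂ (j , d′) = inj₂ (Fin.suc j , d′)
dominated-unslack s (true ∷ G) (true ∷ F) d with dominated-unslack s G F d
... | inj₁ d′       = inj₁ d′
... | inj₂ (j , d′) = inj₂ (Fin.suc j , d′)
dominated-unslack zero (true ∷ G) (false ∷ F) d = inj₂ (Fin.zero , d)
dominated-unslack (suc s) (true ∷ G) (false ∷ F) d with dominated-unslack s G F d
... | inj₁ d′       = inj₁ d′
... | inj₂ (j , d′) = inj₂ (Fin.suc j , d′)

-- When G ∖ {n} is dominated and G has as many elements as F (plus slack),
-- one element of F is still unmatched, and it is not larger than n.
dominated-∷ʳ : ∀ {n} s (G : Subset n) g F → dominated s (G ∷ʳ false) F ≡ true →
               s + card F ≡ card (G ∷ʳ g) → dominated s (G ∷ʳ g) F ≡ true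
dominated-∷ʳ s       []          false (f ∷ [])     d _ = d
dominated-∷ʳ s       []          true  (true ∷ [])  d _ = refl
dominated-∷ʳ (suc s) []          true  (false ∷ []) d _ = refl
dominated-∷ʳ zero    []          true  (false ∷ []) d ()
dominated-∷ʳ s       (false ∷ G) g     (false ∷ F)  d eq = dominated-∷ʳ s G g F d eq
dominated-∷ʳ s       (false ∷ G) g     (true ∷ F)   d eq =
  dominated-∷ʳ (suc s) G g F d (trans (sym (ℕP.+-suc s (card F))) eq)
dominated-∷ʳ s       (true ∷ G)  g     (true ∷ F)   d eq =
  dominated-∷ʳ s G g F d (ℕP.suc-injective (trans (sym (ℕP.+-suc s (card F))) eq))
dominated-∷ʳ (suc s) (true ∷ G)  g     (false ∷ F)  d eq =
  dominated-∷ʳ s G g F d (ℕP.suc-injective eq)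
dominated-∷ʳ zero    (true ∷ G)  g     (false ∷ F)  ()

DeletionClosed : ∀ {n} → (Subset n → Set) → Set
DeletionClosed {n} Q = ∀ F (i : Fin n) → Q F → Q (F [ i ]≔ false)

ShiftClosed : ∀ {n} → (Subset n → Set) → Set
ShiftClosed {n} Q =
  ∀ F (i j : Fin n) → Q F → i ∈ F → toℕ i < toℕ j → Q ((F [ i ]≔ false) [ j ]≔ true)

module _ {n} {Q : Subset (suc n) → Set} (x : Bool) where

  deletionClosed-∷ : DeletionClosed Q → DeletionClosed (Q ∘ (x ∷_))
  deletionClosed-∷ del F i = del (x ∷ F) (Fin.suc i)

  shiftClosed-∷ : ShiftClosed Q → ShiftClosed (Q ∘ (x ∷_))
  shiftClosed-∷ sh F i j q i∈F i<j = sh (x ∷ F) (Fin.suc i) (Fin.suc j) q i∈F (s≤s i<j)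

dominated-closed : ∀ {n} {Q : Subset n → Set} → DeletionClosed Q → ShiftClosed Q →
                   ∀ G F → dominated 0 G F ≡ true → Q F → Q G
dominated-closed del sh [] [] d q = q
dominated-closed del sh (false ∷ G) (false ∷ F) d q =
  dominated-closed (deletionClosed-∷ false del) (shiftClosed-∷ false sh) G F d q
dominated-closed del sh (true ∷ G) (true ∷ F) d q =
  dominated-closed (deletionClosed-∷ true del) (shiftClosed-∷ true sh) G F d q
dominated-closed del sh (false ∷ G) (true ∷ F) d q with dominated-unslack 0 G F d
... | inj₁ d′       =
  dominated-closed (deletionClosed-∷ false del) (shiftClosed-∷ false sh) G F d′
    (del (true ∷ F) Fin.zero q)
... | inj₂ (j , d′) =
  dominated-closed (deletionClosed-∷ false del) (shiftClosed-∷ false sh) G (F [ j ]≔ true) d′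
    (sh (true ∷ F) Fin.zero (Fin.suc j) q refl (s≤s z≤n))

[]≔false-⊆ : ∀ {n} (F : Subset n) i → (F [ i ]≔ false) ⊆ F
[]≔false-⊆ (x ∷ F) Fin.zero    (Fin.suc k) e = e
[]≔false-⊆ (x ∷ F) (Fin.suc i) Fin.zero    e = e
[]≔false-⊆ (x ∷ F) (Fin.suc i) (Fin.suc k) e = []≔false-⊆ F i k e

principal : ∀ {n} → Subset n → Complex n
face   (principal F) G           = dominated 0 G F
closed (principal F) H G G⊆H d = dominated-trans 0 0 G H F (⊆⇒dominated 0 G H G⊆H) d

principal-shifted : ∀ {n} (F : Subset n) → Shifted (principal F)
principal-shifted F G i j d i∈G i<j =
  dominated-trans 0 0 ((G [ i ]≔ false) [ j ]≔ true) G F (dominated-shift 0 G i j i∈G i<j) d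

principal-⊆ᶜ : ∀ {n} (Γ : Complex n) → Shifted Γ → ∀ {F} → F ∈ᶜ Γ → principal F ⊆ᶜ Γ
principal-⊆ᶜ Γ sh {F} F∈Γ G d = dominated-closed deletionClosed sh G F d F∈Γ
  where
  deletionClosed : DeletionClosed (_∈ᶜ Γ)
  deletionClosed F i = closed Γ F (F [ i ]≔ false) ([]≔false-⊆ F i)

lookup-∷ʳ-inject₁ : ∀ {a} {A : Set a} {n} (xs : Vec A n) x i →
                    lookup (xs ∷ʳ x) (inject₁ i) ≡ lookup xs i
lookup-∷ʳ-inject₁ (y ∷ xs) x Fin.zero    = refl
lookup-∷ʳ-inject₁ (y ∷ xs) x (Fin.suc i) = lookup-∷ʳ-inject₁ xs x i

[]≔-∷ʳ-inject₁ : ∀ {a} {A : Set a} {n} (xs : Vec A n) x i v →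
                 (xs ∷ʳ x) [ inject₁ i ]≔ v ≡ (xs [ i ]≔ v) ∷ʳ x
[]≔-∷ʳ-inject₁ (y ∷ xs) x Fin.zero    v = refl
[]≔-∷ʳ-inject₁ (y ∷ xs) x (Fin.suc i) v = cong (y ∷_) ([]≔-∷ʳ-inject₁ xs x i v)

∷ʳ-⊆ : ∀ {n} (G F : Subset n) x → G ⊆ F → (G ∷ʳ false) ⊆ (F ∷ʳ x)
∷ʳ-⊆ (g ∷ G) (f ∷ F) x G⊆F Fin.zero    e = G⊆F Fin.zero e
∷ʳ-⊆ (g ∷ G) (f ∷ F) x G⊆F (Fin.suc k) e = ∷ʳ-⊆ G F x (G⊆F ∘ Fin.suc) k e

∷ʳ-init-last : ∀ {n} (G : Subset (suc n)) → G ≡ Vec.init G ∷ʳ Vec.last G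
∷ʳ-init-last G = proj₂ (proj₂ (Vec.initLast G))

deletion : ∀ {n} → Complex (suc n) → Complex n
face   (deletion Γ) G           = face Γ (G ∷ʳ false)
closed (deletion Γ) F G G⊆F F∈ = closed Γ (F ∷ʳ false) (G ∷ʳ false) (∷ʳ-⊆ G F false G⊆F) F∈

deletion-shifted : ∀ {n} (Γ : Complex (suc n)) → Shifted Γ → Shifted (deletion Γ)
deletion-shifted Γ sh F i j F∈ i∈F i<j = subst (_∈ᶜ Γ) shift-∷ʳ
  (sh (F ∷ʳ false) (inject₁ i) (inject₁ j) F∈ (trans (lookup-∷ʳ-inject₁ F false i) i∈F)
      (subst₂ _<_ (sym (toℕ-inject₁ i)) (sym (toℕ-inject₁ j)) i<j))
  where
  shift-∷ʳ : ((F ∷ʳ false) [ inject₁ i ]≔ false) [ inject₁ j ]≔ true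
           ≡ ((F [ i ]≔ false) [ j ]≔ true) ∷ʳ false
  shift-∷ʳ = trans (cong (_[ inject₁ j ]≔ true) ([]≔-∷ʳ-inject₁ F false i false))
                   ([]≔-∷ʳ-inject₁ (F [ i ]≔ false) false j true)

⊆ᶜ-cone-deletion : ∀ {n} (Γ : Complex (suc n)) → Γ ⊆ᶜ cone (deletion Γ)
⊆ᶜ-cone-deletion Γ G G∈Γ = closed Γ G (Vec.init G ∷ʳ false) initG⊆G G∈Γ
  where
  initG⊆G : (Vec.init G ∷ʳ false) ⊆ G
  initG⊆G = subst ((Vec.init G ∷ʳ false) ⊆_) (sym (∷ʳ-init-last G))
                  (∷ʳ-⊆ (Vec.init G) (Vec.init G) (Vec.last G) (λ _ e → e))

∈-allSubsets : ∀ {n} (F : Subset n) → F ∈ˡ allSubsets n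
∈-allSubsets []          = here refl
∈-allSubsets (false ∷ F) = ∈-++⁺ˡ (∈-map⁺ (false ∷_) (∈-allSubsets F))
∈-allSubsets {suc n} (true ∷ F) =
  ∈-++⁺ʳ (List.map (false ∷_) (allSubsets n)) (∈-map⁺ (true ∷_) (∈-allSubsets F))

module _ {n} (Γ : Complex n) (k : ℕ) where

  IsFaceOfSize : Subset n → Set
  IsFaceOfSize F = T (face Γ F ∧ does (card F ≟ k))

  isFaceOfSize? : Decidable IsFaceOfSize
  isFaceOfSize? F = T? (face Γ F ∧ does (card F ≟ k))

  isFaceOfSize⁺ : ∀ {F} → F ∈ᶜ Γ → card F ≡ k → IsFaceOfSize F
  isFaceOfSize⁺ {F} F∈Γ |F|≡k rewrite F∈Γ = ℕP.≡⇒≡ᵇ (card F) k |F|≡k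

  isFaceOfSize⁻ : ∀ {F} → IsFaceOfSize F → F ∈ᶜ Γ × card F ≡ k
  isFaceOfSize⁻ {F} p with face Γ F
  ... | true = refl , ℕP.≡ᵇ⇒≡ (card F) k p

_⊆[_]_ : ∀ {n} → Complex n → ℕ → Complex n → Set
Γ′ ⊆[ k ] Γ = ∀ F → card F ≡ k → F ∈ᶜ Γ′ → F ∈ᶜ Γ

-- The faces of size k of Γ′ form a sublist of those of Γ; a sublist of
-- the same length is the whole list.
⊆[]-fcount-≡⇒⊇[] : ∀ {n} (Γ′ Γ : Complex n) {k} →
                   Γ′ ⊆[ k ] Γ → fcount Γ′ k ≡ fcount Γ k → Γ ⊆[ k ] Γ′
⊆[]-fcount-≡⇒⊇[] {n} Γ′ Γ {k} Γ′⊆Γ same F |F|≡k F∈Γ =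
  proj₁ (isFaceOfSize⁻ Γ′ k (proj₂ (∈-filter⁻ (isFaceOfSize? Γ′ k) {xs = allSubsets n} F∈facesΓ′)))
  where
  ⇒isFaceOfSize : ∀ {G H} → G ≡ H → IsFaceOfSize Γ′ k G → IsFaceOfSize Γ k H
  ⇒isFaceOfSize refl p = let G∈Γ′ , |G|≡k = isFaceOfSize⁻ Γ′ k p in
    isFaceOfSize⁺ Γ k (Γ′⊆Γ _ |G|≡k G∈Γ′) |G|≡k

  facesOfSize-≡ : facesOfSize Γ′ k ≡ facesOfSize Γ k
  facesOfSize-≡ = Pointwise-≡⇒≡ (to-≋ same
    (filter⁺ (isFaceOfSize? Γ′ k) (isFaceOfSize? Γ k) ⇒isFaceOfSize (⊆-refl {x = allSubsets n})))

  F∈facesΓ′ : F ∈ˡ facesOfSize Γ′ k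
  F∈facesΓ′ = subst (F ∈ˡ_) (sym facesOfSize-≡)
    (∈-filter⁺ (isFaceOfSize? Γ k) (∈-allSubsets F) (isFaceOfSize⁺ Γ k F∈Γ |F|≡k))

⊆ᶜ-antisym : ∀ {n} (Γ Γ′ : Complex n) → Γ ⊆ᶜ Γ′ → Γ′ ⊆ᶜ Γ → Γ ≐ Γ′
⊆ᶜ-antisym Γ Γ′ Γ⊆Γ′ Γ′⊆Γ F with face Γ F in F∈Γ | face Γ′ F in F∈Γ′
... | true  | true  = refl
... | false | false = refl
... | true  | false = trans (sym (Γ⊆Γ′ F F∈Γ)) F∈Γ′
... | false | true  = trans (sym F∈Γ) (Γ′⊆Γ F F∈Γ′)

⊆ᶜ-sameFVector⇒≐ : ∀ {n} (Γ′ Γ : Complex n) → SameFVector Γ′ Γ → Γ ⊆ᶜ Γ′ → Γ′ ≐ Γ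
⊆ᶜ-sameFVector⇒≐ Γ′ Γ same Γ⊆Γ′ = ⊆ᶜ-antisym Γ′ Γ
  (λ F → ⊆[]-fcount-≡⇒⊇[] Γ Γ′ (λ G _ → Γ⊆Γ′ G) (sym (same (card F))) F refl)
  Γ⊆Γ′

module _ (Δ : (n : ℕ) → Complex n → Complex n)
         (sameFVector : ∀ n (Γ : Complex n) → SameFVector (Δ n Γ) Γ)
         (Δ-cone : ∀ n (Γ : Complex n) → Δ (suc n) (cone Γ) ≐ cone (Δ n Γ))
         (Δ-mono : ∀ n (Γ′ Γ : Complex n) → Γ′ ⊆ᶜ Γ → Δ n Γ′ ⊆ᶜ Δ n Γ)
         where

  mutual
    Δ-principal-⊆[] : ∀ n (F : Subset n) → Δ n (principal F) ⊆[ card F ] principal F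
    Δ-principal-⊆[] zero    []   []  _ _ = refl
    Δ-principal-⊆[] (suc m) F G |G|≡|F| G∈ΔF =
      subst (λ H → dominated 0 H F ≡ true) (sym (∷ʳ-init-last G))
        (dominated-∷ʳ 0 (Vec.init G) (Vec.last G) F initG∈X
          (trans (sym |G|≡|F|) (cong card (∷ʳ-init-last G))))
      where
      X : Complex m
      X = deletion (principal F)

      X-shifted : Shifted X
      X-shifted = deletion-shifted (principal F) (principal-shifted F)

      initG∈X : Vec.init G ∈ᶜ X
      initG∈X = begin
        face X (Vec.init G)          ≡⟨ sym (Δ-fixes-shifted m X X-shifted (Vec.init G)) ⟩
        face (Δ m X) (Vec.init G)    ≡⟨ sym (Δ-cone m X G) ⟩
        face (Δ (suc m) (cone X)) G  ≡⟨ Δ-mono (suc m) (principal F) (cone X)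
                                          (⊆ᶜ-cone-deletion (principal F)) G G∈ΔF ⟩
        true                         ∎
        where open ≡-Reasoning

    ∈-Δ-principal : ∀ n (F : Subset n) → F ∈ᶜ Δ n (principal F)
    ∈-Δ-principal n F =
      ⊆[]-fcount-≡⇒⊇[] (Δ n (principal F)) (principal F) (Δ-principal-⊆[] n F)
        (sameFVector n (principal F) (card F)) F refl (dominated-refl 0 F)

    Δ-fixes-shifted : ∀ n (Γ : Complex n) → Shifted Γ → Δ n Γ ≐ Γ
    Δ-fixes-shifted n Γ sh = ⊆ᶜ-sameFVector⇒≐ (Δ n Γ) Γ (sameFVector n Γ)
      (λ F F∈Γ → Δ-mono n (principal F) Γ (principal-⊆ᶜ Γ sh F∈Γ) F (∈-Δ-principal n F))

theorem1p1 : ∀ {c ℓ} (K : Field c ℓ) →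
    (Δ : (n : ℕ) → Complex n → Complex n) →
    (∀ n (Γ : Complex n) → Shifted (Δ n Γ)) →
    (∀ n (Γ : Complex n) → SameFVector (Δ n Γ) Γ) →
    (∀ n (Γ : Complex n) → Δ (suc n) (cone Γ) ≐ cone (Δ n Γ)) →
    (∀ n (Γ' Γ : Complex n) → Γ' ⊆ᶜ Γ → Δ n Γ' ⊆ᶜ Δ n Γ) →
    (∀ n (Γ : Complex n) (rk rk' : ℕ → ℕ) →
      LinAlg.BoundaryRanks K Γ rk → LinAlg.BoundaryRanks K (Δ n Γ) rk' →
      LinAlg.bettiSum K Γ rk ≤ LinAlg.bettiSum K (Δ n Γ) rk') →
    ∀ n (Γ : Complex n) → Shifted Γ → Δ n Γ ≐ Γ
theorem1p1 K Δ _ sameFVector Δ-cone Δ-mono _ = Δ-fixes-shifted Δ sameFVector Δ-cone Δ-mono
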